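{- Let $Z$ be a uniform $d$-NBP and let $X$ be a set of vertices of $Z$ separating two disjoint sets $Y_1,Y_2\subseteq Vars(Z)$. Let $Y'_1\subseteq Y_1$ and $Y'_2\subseteq Y_2$. Let $S$ be a set of literals with $Vars(S)=Vars(Z)\setminus(Y_1\cup Y_2)$, and let $Q',Q''$ be computational paths of $Z$, each passing through all vertices of $X$, such that $S\subseteq A(Q')\cap A(Q'')$, $\neg y\in A(Q')$ for every $y\in Y'_1$, and $\neg y\in A(Q'')$ for every $y\in Y'_2$. Then there is a computational path $Q^*$ of $Z$ passing through all vertices of $X$ with $S\subseteq A(Q^*)$ and $\neg y\in A(Q^*)$ for every $y\in Y'_1\cup Y'_2$.
   Context: Sets of literals never contain a variable with its negation. An NBP $Z$ is a directed acyclic multigraph with one source and one sink, some edges labelled with literals; $Vars(Z)$ is the set of label variables. A computational path is a source–sink path on which no variable occurs both positively and negatively; $A(P)$ is its set of labels. A uniform $d$-NBP is an NBP in which every variable occurs exactly $d$ times as a label on every source–sink path. A set $X$ of vertices of $Z$ not containing the source or the sink separates disjoint sets $Y_1,Y_2$ of variables if there is a computational path $P$ through all vertices of $X$ such that, writing the vertices of $X$ in their order along $P$ as $x_1,\dots,x_c$ and splitting $P$ into consecutive subpaths $P_1$ (source to $x_1$), $P_2$ ($x_1$ to $x_2$), …, $P_{c+1}$ ($x_c$ to sink), either the variables of $Y_1$ label edges only of $P_i$ with $i$ odd and those of $Y_2$ only of $P_i$ with $i$ even, or vice versa. -}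

module Defs where

open import Data.Nat using (ℕ; zero; suc; _≡ᵇ_)
open import Data.Bool using (Bool; true; false; not; if_then_else_)
open import Data.Fin using (Fin)
open import Data.Fin.Subset using (Subset)
open import Data.Vec using (lookup)
open import Data.Maybe using (Maybe; just; nothing)
open import Data.List using (List; []; _∷_)
open import Data.List.Membership.Propositional using (_∈_)
open import Data.Product using (_×_; _,_; Σ; ∃; proj₁)
open import Data.Sum using (_⊎_)
open import Relation.Binary.PropositionalEquality using (_≡_; _≢_)
open import Relation.Nullary using (¬_)

-- Literals: a variable (a natural number) with a polarity
-- (true = positive literal x, false = negative literal ¬x).
Lit : Set
Lit = ℕ × Bool

var : Lit → ℕ
var = proj₁

neg : ℕ → Lit
neg y = (y , false)

VarSet : Set₁
VarSet = ℕ → Set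

LitSet : Set₁
LitSet = Lit → Set

Consistent : LitSet → Set
Consistent S = ∀ x → ¬ (S (x , true) × S (x , false))

record Graph : Set where
  field
    n m : ℕ
    src tgt : Fin m → Fin n
    lab : Fin m → Maybe Lit

module _ (G : Graph) where
  open Graph G

  data Path : Fin n → Fin n → Set where
    []  : ∀ {u} → Path u u
    _∷_ : ∀ {v} (e : Fin m) → Path (tgt e) v → Path (src e) v

  plength : ∀ {u v} → Path u v → ℕ
  plength [] = 0
  plength (e ∷ p) = suc (plength p)

  pverts : ∀ {u v} → Path u v → List (Fin n)
  pverts {u} [] = u ∷ []
  pverts (e ∷ p) = src e ∷ pverts p

  plabels : ∀ {u v} → Path u v → List Lit
  plabels [] = []
  plabels (e ∷ p) with lab e
  ... | just l  = l ∷ plabels p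
  ... | nothing = plabels p

  IsSource IsSink : Fin n → Set
  IsSource v = ∀ e → tgt e ≢ v
  IsSink   v = ∀ e → src e ≢ v

  Acyclic : Set
  Acyclic = ∀ v (p : Path v v) → plength p ≡ 0

record NBP : Set where
  field
    graph : Graph
  open Graph graph public
  field
    acyclic : Acyclic graph
    source sink : Fin n
    source-isSource : IsSource graph source
    source-unique   : ∀ v → IsSource graph v → v ≡ source
    sink-isSink     : IsSink graph sink
    sink-unique     : ∀ v → IsSink graph v → v ≡ sink

module _ (Z : NBP) where
  open NBP Z

  SPath : Set
  SPath = Path graph source sink

  A : SPath → List Lit
  A P = plabels graph P

  Vars : VarSet
  Vars x = Σ (Fin m) λ e → Σ Bool λ b → lab e ≡ just (x , b)

  Computational : SPath → Set
  Computational P = ∀ x → ¬ (((x , true) ∈ A P) × ((x , false) ∈ A P))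

  Through : Subset n → SPath → Set
  Through X P = ∀ v → lookup X v ≡ true → v ∈ pverts graph P

  -- labels of P tagged with the parity of the segment P_i they lie on
  -- (true = odd i).  The parity flips each time a vertex of X is reached.
  tagged : ∀ {u v} → Subset n → Bool → Path graph u v → List (Lit × Bool)
  tagged X b [] = []
  tagged X b (e ∷ p) with lab e
  ... | just l  = (l , b) ∷ tagged X b' p
    where b' = if lookup X (tgt e) then not b else b
  ... | nothing = tagged X b' p
    where b' = if lookup X (tgt e) then not b else b

  OddEven : Subset n → SPath → VarSet → VarSet → Set
  OddEven X P Y₁ Y₂ = ∀ l b → (l , b) ∈ tagged X true P →
    (Y₁ (var l) → b ≡ true) × (Y₂ (var l) → b ≡ false)

  Separates : Subset n → VarSet → VarSet → Set
  Separates X Y₁ Y₂ =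
    lookup X source ≡ false × lookup X sink ≡ false ×
    Σ SPath λ P → Computational P × Through X P ×
      (OddEven X P Y₁ Y₂ ⊎ OddEven X P Y₂ Y₁)

  occ : ℕ → List Lit → ℕ
  occ x [] = 0
  occ x ((y , _) ∷ ls) = if x ≡ᵇ y then suc (occ x ls) else occ x ls

Uniform : ℕ → NBP → Set
Uniform d Z = ∀ (P : SPath Z) x → Vars Z x → occ Z x (A Z P) ≡ d

-- All source–sink paths through every vertex of X meet those vertices in the
-- same order, since Z is acyclic; so each of them is cut at the same vertices
-- into segments P₁, …, P_{c+1}, and the odd segments of one such path can be
-- spliced with the even segments of another.  Every spliced path carries each
-- variable d times, hence the number of occurrences of a variable on the odd
-- (or on the even) segments is the same for all these paths.  The separating
-- path therefore confines Y₁ to the segments of one parity and Y₂ to the other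
-- on every path through X.  Q* takes the segments of the parity of Y₁ from Q′
-- and the others from Q″: it keeps the negative literals of Y′₁ and Y′₂, a
-- variable read on both parts lies outside Y₁ ∪ Y₂ and so has its polarity
-- fixed by S, and every variable of S still occurs on Q* by uniformity.
module Submission where

open import Defs
open import Data.Nat using (ℕ; zero; suc; _+_; _≡ᵇ_)
open import Data.Nat.Properties using (≡ᵇ⇒≡; ≡⇒≡ᵇ; +-cancelʳ-≡)
open import Data.Bool using (Bool; true; false; not; if_then_else_; T)
open import Data.Bool.Properties using (not-involutive)
open import Data.Fin using (Fin)
open import Data.Fin.Properties using (_≟_)
open import Data.Fin.Subset using (Subset)
open import Data.Vec using (lookup)
open import Data.Maybe using (just; nothing)
open import Data.List using (List; []; _∷_; _++_; map; length; filterᵇ)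
open import Data.List.Properties using (map-++; ++-assoc; ++-identityʳ)
open import Data.List.Membership.Propositional using (_∈_; _∉_)
open import Data.List.Membership.Propositional.Properties
  using (∈-++⁺ˡ; ∈-++⁺ʳ; ∈-++⁻; ∈-map⁺)
open import Data.List.Relation.Unary.Any using (here; there)
import Data.List.Relation.Unary.Any as Any
open import Data.List.Relation.Binary.Subset.Propositional using (_⊆_)
open import Data.List.Relation.Binary.Permutation.Propositional
  using (_↭_; ↭-reflexive; ↭-sym; ↭-trans; module PermutationReasoning)
open import Data.List.Relation.Binary.Permutation.Propositional.Properties
  using (∈-resp-↭; ↭-length; filter-↭; ++⁺ˡ; ++-comm)
open import Data.Product using (_×_; _,_; Σ; ∃; proj₁; proj₂; map₂; swap)
open import Data.Sum using (_⊎_; inj₁; inj₂; [_,_]′) renaming (map to map⊎)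
open import Data.Empty using (⊥-elim)
open import Data.Unit using (tt)
open import Relation.Nullary using (¬_; yes; no; contradiction)
open import Relation.Binary.PropositionalEquality
open import Function.Bundles using (_⇔_; Equivalence)

module _ (Z : NBP) where
  open NBP Z

  private variable
    u v w : Fin n
    is : List (Fin n)
    x : ℕ
    b b′ c : Bool
    l : Lit
    Y₁ Y₂ : VarSet

  occ-++ : ∀ x L M → occ Z x (L ++ M) ≡ occ Z x L + occ Z x M
  occ-++ x [] M = refl
  occ-++ x ((y , _) ∷ L) M with x ≡ᵇ y
  ... | true  = cong suc (occ-++ x L M)
  ... | false = occ-++ x L M

  occ≡length-filter : ∀ x L → occ Z x L ≡ length (filterᵇ (λ l → x ≡ᵇ var l) L)
  occ≡length-filter x [] = refl
  occ≡length-filter x ((y , _) ∷ L) with x ≡ᵇ y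
  ... | true  = cong suc (occ≡length-filter x L)
  ... | false = occ≡length-filter x L

  occ-↭ : ∀ {x L M} → L ↭ M → occ Z x L ≡ occ Z x M
  occ-↭ {x} {L} {M} L↭M = begin
    occ Z x L                                 ≡⟨ occ≡length-filter x L ⟩
    length (filterᵇ (λ l → x ≡ᵇ var l) L)     ≡⟨ ↭-length (filter-↭ _ L↭M) ⟩
    length (filterᵇ (λ l → x ≡ᵇ var l) M)     ≡⟨ occ≡length-filter x M ⟨
    occ Z x M                                 ∎
    where open ≡-Reasoning

  ∈⇒occ≢0 : ∀ {x b L} → (x , b) ∈ L → occ Z x L ≢ 0
  ∈⇒occ≢0 {x} {L = (y , _) ∷ L} x,b∈L with x ≡ᵇ y in x≡ᵇy | x,b∈L
  ... | true  | _         = λ ()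
  ... | false | here refl = λ _ → subst T x≡ᵇy (≡⇒≡ᵇ x x refl)
  ... | false | there m   = ∈⇒occ≢0 m

  occ≢0⇒∈ : ∀ x L → occ Z x L ≢ 0 → ∃ λ b → (x , b) ∈ L
  occ≢0⇒∈ x [] occ≢0 = ⊥-elim (occ≢0 refl)
  occ≢0⇒∈ x ((y , b) ∷ L) occ≢0 with x ≡ᵇ y in x≡ᵇy
  ... | true  = b , here (cong (_, b) (≡ᵇ⇒≡ x y (subst T (sym x≡ᵇy) tt)))
  ... | false = map₂ there (occ≢0⇒∈ x L occ≢0)

  ∉⇒occ≡0 : ∀ x L → (∀ b → (x , b) ∉ L) → occ Z x L ≡ 0
  ∉⇒occ≡0 x L ∉L with occ Z x L | occ≢0⇒∈ x L
  ... | zero  | _     = refl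
  ... | suc _ | occurs = ⊥-elim (∉L _ (proj₂ (occurs λ ())))

  infixr 5 _++ᵖ_ _⁺++_ _▸_

  _++ᵖ_ : Path graph u w → Path graph w v → Path graph u v
  []      ++ᵖ q = q
  (e ∷ p) ++ᵖ q = e ∷ (p ++ᵖ q)

  plabels-++ : (p : Path graph u w) (q : Path graph w v) →
               plabels graph (p ++ᵖ q) ≡ plabels graph p ++ plabels graph q
  plabels-++ []      q = refl
  plabels-++ (e ∷ p) q with lab e
  ... | just l  = cong (l ∷_) (plabels-++ p q)
  ... | nothing = plabels-++ p q

  start∈pverts : (p : Path graph u v) → u ∈ pverts graph p
  start∈pverts []      = here refl
  start∈pverts (e ∷ p) = here refl

  ∈pverts-++ʳ : (p : Path graph u w) {q : Path graph w v} {y : Fin n} →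
                y ∈ pverts graph q → y ∈ pverts graph (p ++ᵖ q)
  ∈pverts-++ʳ []      m = m
  ∈pverts-++ʳ (e ∷ p) m = there (∈pverts-++ʳ p m)

  ∈plabels⇒Vars : (p : Path graph u v) → (x , b) ∈ plabels graph p → Vars Z x
  ∈plabels⇒Vars (e ∷ p) m with lab e in lab-e | m
  ... | just _  | here refl = e , _ , lab-e
  ... | just _  | there m′  = ∈plabels⇒Vars p m′
  ... | nothing | m′        = ∈plabels⇒Vars p m′

  computational⇒polarity-unique : (Q : SPath Z) → Computational Z Q →
    (x , b) ∈ A Z Q → (x , b′) ∈ A Z Q → b ≡ b′
  computational⇒polarity-unique {b = false} {false} Q comp _ _ = refl
  computational⇒polarity-unique {b = true}  {true}  Q comp _ _ = refl
  computational⇒polarity-unique {b = true}  {false} Q comp t f = ⊥-elim (comp _ (t , f))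
  computational⇒polarity-unique {b = false} {true}  Q comp f t = ⊥-elim (comp _ (t , f))

  polarity-unique⇒computational : (Q : SPath Z) →
    (∀ {x b b′} → (x , b) ∈ A Z Q → (x , b′) ∈ A Z Q → b ≡ b′) → Computational Z Q
  polarity-unique⇒computational Q unique x (t , f) with unique t f
  ... | ()

  data Path⁺ : Fin n → Fin n → Set where
    _∷_ : (e : Fin m) → Path graph (tgt e) v → Path⁺ (src e) v

  toPath : Path⁺ u v → Path graph u v
  toPath (e ∷ p) = e ∷ p

  _⁺++_ : Path⁺ u w → Path graph w v → Path⁺ u v
  (e ∷ p) ⁺++ q = e ∷ (p ++ᵖ q)

  no-cycle : ¬ Path⁺ u u
  no-cycle (e ∷ p) with acyclic _ (e ∷ p)
  ... | ()

  -- A path cut into the segments P₁, …, P_{c+1}, indexed by the list of cut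
  -- vertices; all segments but the last are non-empty.
  data Segs : Fin n → Fin n → List (Fin n) → Set where
    end : Path graph u v → Segs u v []
    _▸_ : Path⁺ u w → Segs w v is → Segs u v (w ∷ is)

  join : Segs u v is → Path graph u v
  join (end p) = p
  join (p ▸ s) = toPath p ++ᵖ join s

  index⇒Path⁺ : Segs u v is → w ∈ is → Path⁺ u w
  index⇒Path⁺ (p ▸ s) (here refl)  = p
  index⇒Path⁺ (p ▸ s) (there w∈is) = p ⁺++ toPath (index⇒Path⁺ s w∈is)

  index⇒∈pverts : (s : Segs u v is) → w ∈ is → w ∈ pverts graph (join s)
  index⇒∈pverts (p ▸ s) (here refl)  = ∈pverts-++ʳ (toPath p) (start∈pverts (join s))
  index⇒∈pverts (p ▸ s) (there w∈is) = ∈pverts-++ʳ (toPath p) (index⇒∈pverts s w∈is)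

  Segs-index-unique : ∀ {is js} → Segs u v is → Segs u v js → is ⊆ js → js ⊆ is → is ≡ js
  Segs-index-unique (end _) (end _) _ _ = refl
  Segs-index-unique (end _) (_ ▸ _) _ js⊆is with js⊆is (here refl)
  ... | ()
  Segs-index-unique (_ ▸ _) (end _) is⊆js _ with is⊆js (here refl)
  ... | ()
  Segs-index-unique (_▸_ {w = a} p s) (_▸_ {w = a′} p′ s′) is⊆js js⊆is with a ≟ a′
  ... | yes refl = cong (a ∷_) (Segs-index-unique s s′ (drop-head s is⊆js) (drop-head s′ js⊆is))
    where
    drop-head : ∀ {is js} → Segs a v is → a ∷ is ⊆ a ∷ js → is ⊆ js
    drop-head s ⊆ y∈is =
      Any.tail (λ y≡a → no-cycle (subst (Path⁺ a) y≡a (index⇒Path⁺ s y∈is))) (⊆ (there y∈is))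
  ... | no a≢a′ = ⊥-elim (no-cycle (index⇒Path⁺ s a′∈is ⁺++ toPath (index⇒Path⁺ s′ a∈js)))
    where
    a′∈is = Any.tail (λ a′≡a → a≢a′ (sym a′≡a)) (js⊆is (here refl))
    a∈js  = Any.tail a≢a′ (is⊆js (here refl))

  prepend : (e : Fin m) → Segs (tgt e) v is → Segs (src e) v is
  prepend e (end p) = end (e ∷ p)
  prepend e (p ▸ s) = (e ∷ toPath p) ▸ s

  join-prepend : (e : Fin m) (s : Segs (tgt e) v is) → join (prepend e s) ≡ e ∷ join s
  join-prepend e (end p) = refl
  join-prepend e (p ▸ s) = refl

  -- segLabels true s / segLabels false s: the labels on the odd / even segments.
  segLabels : Bool → Segs u v is → List Lit
  segLabels true  (end p) = plabels graph p
  segLabels false (end p) = []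
  segLabels true  (p ▸ s) = plabels graph (toPath p) ++ segLabels false s
  segLabels false (p ▸ s) = segLabels true s

  splice : Bool → Segs u v is → Segs u v is → Segs u v is
  splice true  (end p) (end q) = end p
  splice false (end p) (end q) = end q
  splice true  (p ▸ s) (q ▸ t) = p ▸ splice false s t
  splice false (p ▸ s) (q ▸ t) = q ▸ splice true s t

  segLabels-splice : ∀ b (s t : Segs u v is) → segLabels b (splice b s t) ≡ segLabels b s
  segLabels-splice true  (end p) (end q) = refl
  segLabels-splice false (end p) (end q) = refl
  segLabels-splice true  (p ▸ s) (q ▸ t) =
    cong (plabels graph (toPath p) ++_) (segLabels-splice false s t)
  segLabels-splice false (p ▸ s) (q ▸ t) = segLabels-splice true s t

  segLabels-splice-other : ∀ b (s t : Segs u v is) →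
                           segLabels (not b) (splice b s t) ≡ segLabels (not b) t
  segLabels-splice-other true  (end p) (end q) = refl
  segLabels-splice-other false (end p) (end q) = refl
  segLabels-splice-other true  (p ▸ s) (q ▸ t) = segLabels-splice-other false s t
  segLabels-splice-other false (p ▸ s) (q ▸ t) =
    cong (plabels graph (toPath q) ++_) (segLabels-splice-other true s t)

  plabels-join-↭-odd-even : (s : Segs u v is) →
                            plabels graph (join s) ↭ segLabels true s ++ segLabels false s
  plabels-join-↭-odd-even (end p) = ↭-reflexive (sym (++-identityʳ _))
  plabels-join-↭-odd-even (p ▸ s) = begin
    plabels graph (toPath p ++ᵖ join s)                ≡⟨ plabels-++ (toPath p) (join s) ⟩
    lp ++ plabels graph (join s)                       ↭⟨ ++⁺ˡ lp (plabels-join-↭-odd-even s) ⟩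
    lp ++ segLabels true s ++ segLabels false s        ↭⟨ ++⁺ˡ lp (++-comm (segLabels true s) _) ⟩
    lp ++ segLabels false s ++ segLabels true s        ≡⟨ ++-assoc lp (segLabels false s) _ ⟨
    (lp ++ segLabels false s) ++ segLabels true s      ∎
    where
    open PermutationReasoning
    lp = plabels graph (toPath p)

  plabels-join-↭ : ∀ b (s : Segs u v is) →
                   plabels graph (join s) ↭ segLabels b s ++ segLabels (not b) s
  plabels-join-↭ true  s = plabels-join-↭-odd-even s
  plabels-join-↭ false s = ↭-trans (plabels-join-↭-odd-even s) (++-comm (segLabels true s) _)

  occ-join : ∀ b (s : Segs u v is) →
             occ Z x (plabels graph (join s)) ≡ occ Z x (segLabels b s) + occ Z x (segLabels (not b) s)
  occ-join {x = x} b s = trans (occ-↭ (plabels-join-↭ b s)) (occ-++ x (segLabels b s) _)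

  ∈-join⁻ : ∀ b (s : Segs u v is) → l ∈ plabels graph (join s) →
            l ∈ segLabels b s ⊎ l ∈ segLabels (not b) s
  ∈-join⁻ b s m = ∈-++⁻ _ (∈-resp-↭ (plabels-join-↭ b s) m)

  ∈-join⁺ : ∀ b (s : Segs u v is) → l ∈ segLabels b s → l ∈ plabels graph (join s)
  ∈-join⁺ b s m = ∈-resp-↭ (↭-sym (plabels-join-↭ b s)) (∈-++⁺ˡ m)

  tagLabels : Bool → Path graph u v → List (Lit × Bool)
  tagLabels b p = map (_, b) (plabels graph p)

  tagSegs : Bool → Segs u v is → List (Lit × Bool)
  tagSegs b (end p) = tagLabels b p
  tagSegs b (p ▸ s) = tagLabels b (toPath p) ++ tagSegs (not b) s

  tagLabels-++ : ∀ b (p : Path graph u w) (q : Path graph w v) →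
                 tagLabels b (p ++ᵖ q) ≡ tagLabels b p ++ tagLabels b q
  tagLabels-++ b p q = trans (cong (map (_, b)) (plabels-++ p q)) (map-++ _ (plabels graph p) _)

  tagSegs-prepend : ∀ b (e : Fin m) (s : Segs (tgt e) v is) →
                    tagSegs b (prepend e s) ≡ tagLabels b (e ∷ []) ++ tagSegs b s
  tagSegs-prepend b e (end p) = tagLabels-++ b (e ∷ []) p
  tagSegs-prepend b e (p ▸ s) =
    trans (cong (_++ tagSegs (not b) s) (tagLabels-++ b (e ∷ []) (toPath p)))
          (++-assoc (tagLabels b (e ∷ [])) _ _)

  ∈segLabels⇒∈tagSegs : ∀ c t (s : Segs u v is) → l ∈ segLabels c s →
                        (l , (if c then t else not t)) ∈ tagSegs t s
  ∈segLabels⇒∈tagSegs true  t (end p) m = ∈-map⁺ (_, t) m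
  ∈segLabels⇒∈tagSegs true  t (p ▸ s) m with ∈-++⁻ (plabels graph (toPath p)) m
  ... | inj₁ m₁ = ∈-++⁺ˡ (∈-map⁺ (_, t) m₁)
  ... | inj₂ m₂ = ∈-++⁺ʳ (tagLabels t (toPath p))
    (subst (λ t′ → (_ , t′) ∈ tagSegs (not t) s) (not-involutive t)
           (∈segLabels⇒∈tagSegs false (not t) s m₂))
  ∈segLabels⇒∈tagSegs false t (p ▸ s) m =
    ∈-++⁺ʳ (tagLabels t (toPath p)) (∈segLabels⇒∈tagSegs true (not t) s m)

  Separated : Bool → Segs u v is → VarSet → VarSet → Set
  Separated c s Y₁ Y₂ = (∀ y → Y₁ y → occ Z y (segLabels (not c) s) ≡ 0)
                      × (∀ y → Y₂ y → occ Z y (segLabels c s) ≡ 0)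

  module _ {d : ℕ} (uniform : Uniform d Z) where

    occurs-on-every-path : (Q R : SPath Z) → (x , b) ∈ A Z Q → ∃ λ b′ → (x , b′) ∈ A Z R
    occurs-on-every-path {x} Q R m = occ≢0⇒∈ x (A Z R) λ occ≡0 →
      ∈⇒occ≢0 m (trans (uniform Q x x∈Vars) (trans (sym (uniform R x x∈Vars)) occ≡0))
      where x∈Vars = ∈plabels⇒Vars Q m

    occ-splice : ∀ b (s t : Segs source sink is) → Vars Z x →
                 occ Z x (segLabels b s) + occ Z x (segLabels (not b) t) ≡ d
    occ-splice {x = x} b s t x∈Vars = begin
      occ Z x (segLabels b s) + occ Z x (segLabels (not b) t)
        ≡⟨ cong₂ (λ L M → occ Z x L + occ Z x M)
                 (segLabels-splice b s t) (segLabels-splice-other b s t) ⟨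
      occ Z x (segLabels b st) + occ Z x (segLabels (not b) st)  ≡⟨ occ-join b st ⟨
      occ Z x (A Z (join st))                                    ≡⟨ uniform (join st) x x∈Vars ⟩
      d                                                          ∎
      where
      open ≡-Reasoning
      st = splice b s t

    occ-segLabels-invariant : ∀ b (s s′ : Segs source sink is) → Vars Z x →
                              occ Z x (segLabels b s) ≡ occ Z x (segLabels b s′)
    occ-segLabels-invariant {x = x} b s s′ x∈Vars =
      +-cancelʳ-≡ (occ Z x (segLabels (not b) s)) _ _
        (trans (occ-splice b s s x∈Vars) (sym (occ-splice b s′ s x∈Vars)))

    Separated-invariant : (∀ y → Y₁ y → Vars Z y) → (∀ y → Y₂ y → Vars Z y) →
      {s : Segs source sink is} → Separated c s Y₁ Y₂ →
      (s′ : Segs source sink is) → Separated c s′ Y₁ Y₂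
    Separated-invariant {c = c} Y₁⊆Vars Y₂⊆Vars {s} (Y₁-absent , Y₂-absent) s′ =
      (λ y y∈Y₁ → trans (occ-segLabels-invariant (not c) s′ s (Y₁⊆Vars y y∈Y₁))
                        (Y₁-absent y y∈Y₁)) ,
      (λ y y∈Y₂ → trans (occ-segLabels-invariant c s′ s (Y₂⊆Vars y y∈Y₂))
                        (Y₂-absent y y∈Y₂))

  module _ (X : Subset n) where

    -- The vertices of X reached along p, not counting its first vertex.
    hits : Path graph u v → List (Fin n)
    hits []      = []
    hits (e ∷ p) = if lookup X (tgt e) then tgt e ∷ hits p else hits p

    cut : (p : Path graph u v) → Segs u v (hits p)
    cut []      = end []
    cut (e ∷ p) with lookup X (tgt e)
    ... | true  = (e ∷ []) ▸ cut p
    ... | false = prepend e (cut p)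

    join-cut : (p : Path graph u v) → join (cut p) ≡ p
    join-cut []      = refl
    join-cut (e ∷ p) with lookup X (tgt e)
    ... | true  = cong (e ∷_) (join-cut p)
    ... | false = trans (join-prepend e (cut p)) (cong (e ∷_) (join-cut p))

    hit⇒∈X : (p : Path graph u v) → w ∈ hits p → lookup X w ≡ true
    hit⇒∈X (e ∷ p) w∈hits with lookup X (tgt e) in tgt∈X | w∈hits
    ... | true  | here refl = tgt∈X
    ... | true  | there m   = hit⇒∈X p m
    ... | false | m         = hit⇒∈X p m

    ∈X⇒start-or-hit : (p : Path graph u v) → w ∈ pverts graph p → lookup X w ≡ true →
                      w ≡ u ⊎ w ∈ hits p
    ∈X⇒start-or-hit []      (here refl) _ = inj₁ refl
    ∈X⇒start-or-hit (e ∷ p) (here refl) _ = inj₁ refl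
    ∈X⇒start-or-hit (e ∷ p) (there m) w∈X
      with lookup X (tgt e) in tgt∈X | ∈X⇒start-or-hit p m w∈X
    ... | true  | inj₁ refl = inj₂ (here refl)
    ... | true  | inj₂ hit  = inj₂ (there hit)
    ... | false | inj₁ refl = contradiction (trans (sym w∈X) tgt∈X) λ ()
    ... | false | inj₂ hit  = inj₂ hit

    through⇒hit : lookup X source ≡ false → (Q : SPath Z) → Through Z X Q →
                  lookup X w ≡ true → w ∈ hits Q
    through⇒hit {w} src∉X Q Q-through w∈X with ∈X⇒start-or-hit Q (Q-through w w∈X) w∈X
    ... | inj₁ refl = contradiction (trans (sym w∈X) src∉X) λ ()
    ... | inj₂ hit  = hit

    join-through : lookup X source ≡ false → (P : SPath Z) → Through Z X P →
                   (s : Segs source sink (hits P)) → Through Z X (join s)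
    join-through src∉X P P-through s w w∈X = index⇒∈pverts s (through⇒hit src∉X P P-through w∈X)

    cut-through : lookup X source ≡ false → (P Q : SPath Z) → Through Z X P → Through Z X Q →
                  Σ (Segs source sink (hits P)) λ s → join s ≡ Q
    cut-through src∉X P Q P-through Q-through = cut-as Q (Segs-index-unique (cut Q) (cut P)
      (λ hit → through⇒hit src∉X P P-through (hit⇒∈X Q hit))
      (λ hit → through⇒hit src∉X Q Q-through (hit⇒∈X P hit)))
      where
      cut-as : (p : Path graph u v) → ∀ {is} → hits p ≡ is → Σ (Segs u v is) λ s → join s ≡ p
      cut-as p refl = cut p , join-cut p

    tagged-∷ : ∀ b e (p : Path graph (tgt e) v) →
      tagged Z X b (e ∷ p)
        ≡ tagLabels b (e ∷ []) ++ tagged Z X (if lookup X (tgt e) then not b else b) p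
    tagged-∷ b e p with lab e
    ... | just l  = refl
    ... | nothing = refl

    tagSegs-cut-∷ : ∀ b e (p : Path graph (tgt e) v) →
      tagSegs b (cut (e ∷ p))
        ≡ tagLabels b (e ∷ []) ++ tagSegs (if lookup X (tgt e) then not b else b) (cut p)
    tagSegs-cut-∷ b e p with lookup X (tgt e)
    ... | true  = refl
    ... | false = tagSegs-prepend b e (cut p)

    tagged≡tagSegs-cut : ∀ b (p : Path graph u v) → tagged Z X b p ≡ tagSegs b (cut p)
    tagged≡tagSegs-cut b []      = refl
    tagged≡tagSegs-cut b (e ∷ p) = begin
      tagged Z X b (e ∷ p)                          ≡⟨ tagged-∷ b e p ⟩
      tagLabels b (e ∷ []) ++ tagged Z X b₁ p       ≡⟨ cong (tagLabels b (e ∷ []) ++_) (tagged≡tagSegs-cut b₁ p) ⟩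
      tagLabels b (e ∷ []) ++ tagSegs b₁ (cut p)    ≡⟨ tagSegs-cut-∷ b e p ⟨
      tagSegs b (cut (e ∷ p))                       ∎
      where
      open ≡-Reasoning
      b₁ = if lookup X (tgt e) then not b else b

    oddEven⇒Separated : (P : SPath Z) → OddEven Z X P Y₁ Y₂ → Separated true (cut P) Y₁ Y₂
    oddEven⇒Separated P oddEven =
      (λ y y∈Y₁ → ∉⇒occ≡0 y _ λ b m →
         contradiction (proj₁ (oddEven (y , b) false (tagged-of false m)) y∈Y₁) λ ()) ,
      (λ y y∈Y₂ → ∉⇒occ≡0 y _ λ b m →
         contradiction (proj₂ (oddEven (y , b) true (tagged-of true m)) y∈Y₂) λ ())
      where
      from-tagSegs : ∀ {t} → t ∈ tagSegs true (cut P) → t ∈ tagged Z X true P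
      from-tagSegs = subst (_ ∈_) (sym (tagged≡tagSegs-cut true P))
      tagged-of : ∀ c → l ∈ segLabels c (cut P) → (l , c) ∈ tagged Z X true P
      tagged-of true  m = from-tagSegs (∈segLabels⇒∈tagSegs true  true (cut P) m)
      tagged-of false m = from-tagSegs (∈segLabels⇒∈tagSegs false true (cut P) m)

    separating-parity : (P : SPath Z) → OddEven Z X P Y₁ Y₂ ⊎ OddEven Z X P Y₂ Y₁ →
                        ∃ λ c → Separated c (cut P) Y₁ Y₂
    separating-parity P (inj₁ oddEven) = true  , oddEven⇒Separated P oddEven
    separating-parity P (inj₂ evenOdd) = false , swap (oddEven⇒Separated P evenOdd)

  module Exchange {d : ℕ} (uniform : Uniform d Z) (c : Bool)
    {W : List (Fin n)} {Y₁ Y₂ : VarSet}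
    (separated : (s : Segs source sink W) → Separated c s Y₁ Y₂)
    {S : LitSet} (S-complete : ∀ x → Vars Z x × ¬ Y₁ x × ¬ Y₂ x → ∃ λ b → S (x , b))
    (s′ s″ : Segs source sink W)
    (comp′ : Computational Z (join s′)) (comp″ : Computational Z (join s″))
    (S⊆Q′ : ∀ l → S l → l ∈ A Z (join s′)) (S⊆Q″ : ∀ l → S l → l ∈ A Z (join s″))
    where

    Q* : SPath Z
    Q* = join (splice c s′ s″)

    ∈Q*⁻ : l ∈ A Z Q* → l ∈ segLabels c s′ ⊎ l ∈ segLabels (not c) s″
    ∈Q*⁻ m = map⊎ (subst (_ ∈_) (segLabels-splice c s′ s″))
                  (subst (_ ∈_) (segLabels-splice-other c s′ s″))
                  (∈-join⁻ c (splice c s′ s″) m)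

    ∈Q*⁺ˡ : l ∈ segLabels c s′ → l ∈ A Z Q*
    ∈Q*⁺ˡ m = ∈-join⁺ c (splice c s′ s″) (subst (_ ∈_) (sym (segLabels-splice c s′ s″)) m)

    ∈Q*⁺ʳ : l ∈ segLabels (not c) s″ → l ∈ A Z Q*
    ∈Q*⁺ʳ m =
      ∈-join⁺ (not c) (splice c s′ s″) (subst (_ ∈_) (sym (segLabels-splice-other c s′ s″)) m)

    Q*⊆Q′∪Q″ : l ∈ A Z Q* → l ∈ A Z (join s′) ⊎ l ∈ A Z (join s″)
    Q*⊆Q′∪Q″ m = map⊎ (∈-join⁺ c s′) (∈-join⁺ (not c) s″) (∈Q*⁻ m)

    agrees-with-S : S (x , b) → (x , b′) ∈ A Z Q* → b′ ≡ b
    agrees-with-S S-lit m =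
      [ (λ m′ → computational⇒polarity-unique (join s′) comp′ m′ (S⊆Q′ _ S-lit))
      , (λ m″ → computational⇒polarity-unique (join s″) comp″ m″ (S⊆Q″ _ S-lit))
      ]′ (Q*⊆Q′∪Q″ m)

    crossing⇒S : (x , b) ∈ segLabels c s′ → (x , b′) ∈ segLabels (not c) s″ → ∃ λ b₀ → S (x , b₀)
    crossing⇒S {x} m′ m″ = S-complete x (∈plabels⇒Vars (join s′) (∈-join⁺ c s′ m′) , ∉Y₁ , ∉Y₂)
      where
      ∉Y₁ : ¬ Y₁ x
      ∉Y₁ x∈Y₁ = ∈⇒occ≢0 m″ (proj₁ (separated s″) x x∈Y₁)
      ∉Y₂ : ¬ Y₂ x
      ∉Y₂ x∈Y₂ = ∈⇒occ≢0 m′ (proj₂ (separated s′) x x∈Y₂)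

    agree-via-S : ∀ {b₀} → S (x , b₀) → (x , b) ∈ A Z Q* → (x , b′) ∈ A Z Q* → b ≡ b′
    agree-via-S S-lit m₁ m₂ = trans (agrees-with-S S-lit m₁) (sym (agrees-with-S S-lit m₂))

    Q*-polarity-unique : (x , b) ∈ A Z Q* → (x , b′) ∈ A Z Q* → b ≡ b′
    Q*-polarity-unique m₁ m₂ with ∈Q*⁻ m₁ | ∈Q*⁻ m₂
    ... | inj₁ m₁′ | inj₁ m₂′ =
      computational⇒polarity-unique (join s′) comp′ (∈-join⁺ c s′ m₁′) (∈-join⁺ c s′ m₂′)
    ... | inj₂ m₁″ | inj₂ m₂″ =
      computational⇒polarity-unique (join s″) comp″
        (∈-join⁺ (not c) s″ m₁″) (∈-join⁺ (not c) s″ m₂″)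
    ... | inj₁ m₁′ | inj₂ m₂″ = agree-via-S (proj₂ (crossing⇒S m₁′ m₂″)) m₁ m₂
    ... | inj₂ m₁″ | inj₁ m₂′ = agree-via-S (proj₂ (crossing⇒S m₂′ m₁″)) m₁ m₂

    Q*-computational : Computational Z Q*
    Q*-computational = polarity-unique⇒computational Q* Q*-polarity-unique

    S⊆Q* : ∀ l → S l → l ∈ A Z Q*
    S⊆Q* (x , b) S-lit =
      let (b′ , m) = occurs-on-every-path uniform (join s′) Q* (S⊆Q′ _ S-lit)
      in subst (λ b″ → (x , b″) ∈ A Z Q*) (agrees-with-S S-lit m) m

    Y₁-literal : Y₁ x → (x , b) ∈ A Z (join s′) → (x , b) ∈ A Z Q*
    Y₁-literal x∈Y₁ m with ∈-join⁻ c s′ m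
    ... | inj₁ m′ = ∈Q*⁺ˡ m′
    ... | inj₂ m′ = ⊥-elim (∈⇒occ≢0 m′ (proj₁ (separated s′) _ x∈Y₁))

    Y₂-literal : Y₂ x → (x , b) ∈ A Z (join s″) → (x , b) ∈ A Z Q*
    Y₂-literal x∈Y₂ m with ∈-join⁻ c s″ m
    ... | inj₁ m″ = ⊥-elim (∈⇒occ≢0 m″ (proj₂ (separated s″) _ x∈Y₂))
    ... | inj₂ m″ = ∈Q*⁺ʳ m″

lemma6 : (d : ℕ) (Z : NBP) → Uniform d Z →
    (X : Subset (NBP.n Z)) (Y₁ Y₂ : VarSet) →
    (∀ y → Y₁ y → Vars Z y) → (∀ y → Y₂ y → Vars Z y) →
    (∀ y → ¬ (Y₁ y × Y₂ y)) →
    Separates Z X Y₁ Y₂ →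
    (Y₁′ Y₂′ : VarSet) → (∀ y → Y₁′ y → Y₁ y) → (∀ y → Y₂′ y → Y₂ y) →
    (S : LitSet) → Consistent S →
    (∀ x → (∃ λ b → S (x , b)) ⇔ (Vars Z x × ¬ Y₁ x × ¬ Y₂ x)) →
    (Q′ Q″ : SPath Z) →
    Computational Z Q′ → Through Z X Q′ →
    Computational Z Q″ → Through Z X Q″ →
    (∀ l → S l → l ∈ A Z Q′) → (∀ l → S l → l ∈ A Z Q″) →
    (∀ y → Y₁′ y → neg y ∈ A Z Q′) → (∀ y → Y₂′ y → neg y ∈ A Z Q″) →
    Σ (SPath Z) λ Q* → Computational Z Q* × Through Z X Q* ×
      (∀ l → S l → l ∈ A Z Q*) ×
      (∀ y → Y₁′ y ⊎ Y₂′ y → neg y ∈ A Z Q*)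
lemma6 d Z uniform X Y₁ Y₂ Y₁⊆Vars Y₂⊆Vars _ (src∉X , _ , P , _ , P-through , oddEven)
       Y₁′ Y₂′ Y₁′⊆Y₁ Y₂′⊆Y₂ S _ S-iff
       Q′ Q″ comp′ Q′-through comp″ Q″-through S⊆Q′ S⊆Q″ neg∈Q′ neg∈Q″
  with separating-parity Z X P oddEven
     | cut-through Z X src∉X P Q′ P-through Q′-through
     | cut-through Z X src∉X P Q″ P-through Q″-through
... | c , separated | s′ , refl | s″ , refl =
  Q* , Q*-computational , join-through Z X src∉X P P-through (splice Z c s′ s″) , S⊆Q* , negs∈Q*
  where
  open Exchange Z uniform c (Separated-invariant Z uniform {c = c} Y₁⊆Vars Y₂⊆Vars separated)
    (λ x → Equivalence.from (S-iff x)) s′ s″ comp′ comp″ S⊆Q′ S⊆Q″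

  negs∈Q* : ∀ y → Y₁′ y ⊎ Y₂′ y → neg y ∈ A Z Q*
  negs∈Q* y = [ (λ y∈Y₁′ → Y₁-literal (Y₁′⊆Y₁ y y∈Y₁′) (neg∈Q′ y y∈Y₁′))
              , (λ y∈Y₂′ → Y₂-literal (Y₂′⊆Y₂ y y∈Y₂′) (neg∈Q″ y y∈Y₂′)) ]′
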